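{- Let $n>2$ be an integer, let $k$ be an odd integer with $1<k<2^{n}$, and let $r$ be the non-negative integer with $2^r<k<2^{r+1}$. Then $P_{k}(n)=\langle\{k2^{n+i}+1\mid i=0,1,\dots,n+r\}\rangle$.
   Context: $\mathbb{N}$ denotes the set of non-negative integers. For $A\subseteq\mathbb{N}$, $\langle A\rangle$ denotes the set of all finite $\mathbb{N}$-linear combinations of elements of $A$. $P_k(n)=\langle\{k2^{n+i}+1\mid i\in\mathbb{N}\}\rangle$ (the Proth numerical semigroup). -}

module Defs where

open import Data.Nat using (ℕ; _+_; _*_; _^_; _≤_)
open import Data.Product using (∃-syntax; _×_)
open import Relation.Binary.PropositionalEquality using (_≡_)

-- ⟨ A ⟩ : the set of all finite ℕ-linear combinations of elements of A,
-- i.e. the smallest subset of ℕ containing 0 and closed under adding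
-- an element of A. Subsets of ℕ are predicates ℕ → Set.
data ⟨_⟩ (A : ℕ → Set) : ℕ → Set where
  gen-zero : ⟨ A ⟩ 0
  gen-add  : ∀ {a x} → A a → ⟨ A ⟩ x → ⟨ A ⟩ (a + x)

ProthGens : ℕ → ℕ → ℕ → Set
ProthGens k n a = ∃[ i ] a ≡ k * 2 ^ (n + i) + 1

P : ℕ → ℕ → ℕ → Set
P k n = ⟨ ProthGens k n ⟩

ProthGensUpTo : ℕ → ℕ → ℕ → ℕ → Set
ProthGensUpTo k n m a = ∃[ i ] (i ≤ m × a ≡ k * 2 ^ (n + i) + 1)

{-# OPTIONS --safe #-}
-- Write N = k 2^n and g i = N 2^i + 1, so that P k n = ⟨ g 0 , g 1 , … ⟩.  The
-- bounds 2^r < k < 2^(r+1) put 2^(n+r+1) between N + 2 and 2N + 1 (N is even),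
-- which makes g (n+r+1) = (2 + u) g 0 + v g 1 for suitable u, v ∈ ℕ.  From then on
-- doubling stays inside the semigroup: if g j = 2 g 0 + t then
-- g (j+1) = 2 g j − 1 = 4 g 0 − 1 + 2t = 2 g 0 + (g 1 + 2t), since 2 g 0 = g 1 + 1.
-- Hence every generator beyond index n + r is redundant.
module Submission where

open import Defs
open import Data.Nat using (ℕ; zero; suc; _+_; _*_; _^_; _≤_; _<_; z≤n; s≤s)
open import Data.Nat.Properties
open import Data.Nat.Divisibility using (_∣_; divides; ∣n⇒∣m*n; m∣m*n)
open import Data.Nat.Tactic.RingSolver using (solve-∀)
open import Data.Product using (Σ-syntax; _×_; _,_)
open import Function.Bundles using (_⇔_; mk⇔)
open import Relation.Binary.PropositionalEquality using (_≡_; refl; sym; trans; cong; subst; module ≡-Reasoning)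
open import Relation.Nullary using (¬_; yes; no)
open import Level using (0ℓ)
open import Relation.Unary using (Pred; _⊆_)

module _ {A : Pred ℕ 0ℓ} where

  ⟨⟩-generator : A ⊆ ⟨ A ⟩
  ⟨⟩-generator {a} g = subst ⟨ A ⟩ (+-identityʳ a) (gen-add g gen-zero)

  ⟨⟩-+ : ∀ {x y} → ⟨ A ⟩ x → ⟨ A ⟩ y → ⟨ A ⟩ (x + y)
  ⟨⟩-+ gen-zero q = q
  ⟨⟩-+ {y = y} (gen-add {a} {x} g p) q = subst ⟨ A ⟩ (sym (+-assoc a x y)) (gen-add g (⟨⟩-+ p q))

  ⟨⟩-* : ∀ m {x} → ⟨ A ⟩ x → ⟨ A ⟩ (m * x)
  ⟨⟩-* zero    p = gen-zero
  ⟨⟩-* (suc m) p = ⟨⟩-+ p (⟨⟩-* m p)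

⟨⟩-mono : ∀ {A B : Pred ℕ 0ℓ} → A ⊆ ⟨ B ⟩ → ⟨ A ⟩ ⊆ ⟨ B ⟩
⟨⟩-mono A⊆B gen-zero      = gen-zero
⟨⟩-mono A⊆B (gen-add g p) = ⟨⟩-+ (A⊆B g) (⟨⟩-mono A⊆B p)

even-<⇒+2≤ : ∀ {a b} → 2 ∣ a → 2 ∣ b → a < b → a + 2 ≤ b
even-<⇒+2≤ {b = b} (divides p refl) (divides q refl) a<b =
  subst (_≤ b) (+-comm 2 (p * 2)) (*-monoˡ-≤ 2 (*-cancelʳ-< 2 p q a<b))

doubling-identity : ∀ N X t → N * X + 1 ≡ 2 * (N + 1) + t →
                    N * (2 * X) + 1 ≡ 2 * (N + 1) + ((2 * N + 1) + 2 * t)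
doubling-identity N X t e = +-cancelʳ-≡ 1 _ _ (begin
  N * (2 * X) + 1 + 1                       ≡⟨ double N X ⟩
  2 * (N * X + 1)                           ≡⟨ cong (2 *_) e ⟩
  2 * (2 * (N + 1) + t)                     ≡⟨ regroup N t ⟩
  2 * (N + 1) + ((2 * N + 1) + 2 * t) + 1   ∎)
  where
  open ≡-Reasoning
  double : ∀ N X → N * (2 * X) + 1 + 1 ≡ 2 * (N * X + 1)
  double = solve-∀
  regroup : ∀ N t → 2 * (2 * (N + 1) + t) ≡ 2 * (N + 1) + ((2 * N + 1) + 2 * t) + 1
  regroup = solve-∀

window-identity : ∀ u v → let N = suc (u + v) in
                  N * (N + 2 + v) + 1 ≡ 2 * (N + 1) + (u * (N + 1) + v * (2 * N + 1))
window-identity = solve-∀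

window-size : ∀ N W u v → N + 2 + v ≡ W → W + u ≡ 2 * N + 1 → suc (u + v) ≡ N
window-size N W u v e₁ e₂ = +-cancelʳ-≡ (N + 1) _ _ (begin
  suc (u + v) + (N + 1)   ≡⟨ shuffle N u v ⟩
  N + 2 + v + u           ≡⟨ cong (_+ u) e₁ ⟩
  W + u                   ≡⟨ e₂ ⟩
  2 * N + 1               ≡⟨ double N ⟩
  N + (N + 1)             ∎)
  where
  open ≡-Reasoning
  shuffle : ∀ N u v → suc (u + v) + (N + 1) ≡ N + 2 + v + u
  shuffle = solve-∀
  double : ∀ N → 2 * N + 1 ≡ N + (N + 1)
  double = solve-∀

module _ {A : Pred ℕ 0ℓ} {N M : ℕ}
         (g₀ : ⟨ A ⟩ (N + 1)) (g₁ : ⟨ A ⟩ (2 * N + 1))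
         (lower : N + 2 ≤ 2 ^ M) (upper : 2 ^ M ≤ 2 * N + 1) where

  -- Two copies of g₀ = N + 1 are kept apart because 4 g₀ − 1 = 2 g₀ + g₁.
  Excess : ℕ → Set
  Excess j = Σ[ t ∈ ℕ ] ⟨ A ⟩ t × N * 2 ^ j + 1 ≡ 2 * (N + 1) + t

  excess-window : Excess M
  excess-window with v , e₁ ← m≤n⇒∃[o]m+o≡n lower | u , e₂ ← m≤n⇒∃[o]m+o≡n upper
    with refl ← window-size N (2 ^ M) u v e₁ e₂ =
    u * (N + 1) + v * (2 * N + 1) , ⟨⟩-+ (⟨⟩-* u g₀) (⟨⟩-* v g₁) ,
    subst (λ W → N * W + 1 ≡ _) e₁ (window-identity u v)

  excess-double : ∀ {j} → Excess j → Excess (suc j)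
  excess-double {j} (t , t∈ , e) =
    (2 * N + 1) + 2 * t , ⟨⟩-+ g₁ (⟨⟩-* 2 t∈) , doubling-identity N (2 ^ j) t e

  excess-beyond : ∀ d → Excess (d + M)
  excess-beyond zero    = excess-window
  excess-beyond (suc d) = excess-double {d + M} (excess-beyond d)

  ⟨⟩-beyond-window : ∀ {j} → M ≤ j → ⟨ A ⟩ (N * 2 ^ j + 1)
  ⟨⟩-beyond-window M≤j with d , refl ← m≤n⇒∃[o]m+o≡n M≤j
    with t , t∈ , e ← subst Excess (+-comm d M) (excess-beyond d) =
    subst ⟨ A ⟩ (sym e) (⟨⟩-+ (⟨⟩-* 2 g₀) t∈)

proth-exponent : ∀ k n i → k * 2 ^ (n + i) ≡ k * 2 ^ n * 2 ^ i
proth-exponent k n i = trans (cong (k *_) (^-distribˡ-+-* 2 n i)) (sym (*-assoc k (2 ^ n) (2 ^ i)))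

proth-window : ∀ n k r → 2 ^ r < k → k < 2 ^ (r + 1) →
               let N = k * 2 ^ suc n ; M = suc (suc n + r) in
               N + 2 ≤ 2 ^ M × 2 ^ M ≤ 2 * N + 1
proth-window n k r 2^r<k k<2^r+1 =
  even-<⇒+2≤ (∣n⇒∣m*n k (m∣m*n (2 ^ n))) (m∣m*n (2 ^ (suc n + r))) N<2^M ,
  ≤-trans (*-monoʳ-≤ 2 (<⇒≤ 2^[M-1]<N)) (m≤m+n (2 * N) 1)
  where
  N = k * 2 ^ suc n

  2^[M-1]<N : 2 ^ (suc n + r) < N
  2^[M-1]<N = subst (_< N) (trans (*-comm (2 ^ r) _) (sym (^-distribˡ-+-* 2 (suc n) r)))
                (*-monoˡ-< (2 ^ suc n) {{m^n≢0 2 (suc n)}} 2^r<k)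

  N<2^M : N < 2 ^ suc (suc n + r)
  N<2^M = subst (N <_) (trans (sym (^-distribˡ-+-* 2 (r + 1) (suc n))) (cong (2 ^_) (exponent r n)))
            (*-monoˡ-< (2 ^ suc n) {{m^n≢0 2 (suc n)}} k<2^r+1)
    where
    exponent : ∀ r n → r + 1 + suc n ≡ suc (suc n + r)
    exponent = solve-∀

theorem3 : (n k r : ℕ) → 2 < n → ¬ (2 ∣ k) → 1 < k → k < 2 ^ n →
    2 ^ r < k → k < 2 ^ (r + 1) →
    (x : ℕ) → P k n x ⇔ ⟨ ProthGensUpTo k n (n + r) ⟩ x
theorem3 n@(suc n′) k r (s≤s _) _ _ _ 2^r<k k<2^r+1 x =
  mk⇔ (⟨⟩-mono generator) (⟨⟩-mono (λ (i , _ , e) → ⟨⟩-generator (i , e)))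
  where
  N = k * 2 ^ n
  S = ⟨ ProthGensUpTo k n (n + r) ⟩

  listed : ∀ {i} → i ≤ n + r → S (N * 2 ^ i + 1)
  listed {i} i≤ = ⟨⟩-generator (i , i≤ , cong (_+ 1) (sym (proth-exponent k n i)))

  every : ∀ i → S (N * 2 ^ i + 1)
  every i with i ≤? n + r | proth-window n′ k r 2^r<k k<2^r+1
  ... | yes i≤ | _ = listed i≤
  ... | no i≰ | lower , upper = ⟨⟩-beyond-window
    (subst S (cong (_+ 1) (*-identityʳ N)) (listed z≤n))
    (subst S (cong (_+ 1) (*-comm N 2)) (listed (s≤s z≤n)))
    lower upper (≰⇒> i≰)

  generator : ProthGens k n ⊆ S
  generator (i , refl) = subst S (cong (_+ 1) (sym (proth-exponent k n i))) (every i)
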